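{- Let $G\cong\mathbb{Z}_{\ell_1}\times\cdots\times\mathbb{Z}_{\ell_r}$ be a finite abelian group with exponent $\ell^*$, let $I$ be a finite multiset with elements from $G$, let $K\le\mathbb{Z}_{\ell^*}^\times$ be a subgroup of the group of all multipliers of $I$, and let $\sigma=\sum_{i\in I} i$. If $\gcd(|I|,\ell^*)=1$, then $$I-|I|^{\phi(\ell^*)-1}\sigma=\alpha_1 s_1K\cup\alpha_2 s_2K\cup\cdots\cup\alpha_m s_mK$$ for some $s_1,\ldots,s_m\in G$ and $\alpha_1,\ldots,\alpha_m\in\mathbb{Z}_{\ge0}$, where the union is disjoint.
   Context: A multiset $I$ with elements from $G$ assigns a multiplicity $\mathrm{m}_I(g)\in\mathbb{Z}_{\ge0}$ to each $g\in G$; $|I|=\sum_g \mathrm{m}_I(g)$, and $\sigma=\sum_{i\in I}i=\sum_g \mathrm{m}_I(g)\,g$. For $g\in G$, $I+g$ is the multiset with $\mathrm{m}_{I+g}(x+g)=\mathrm{m}_I(x)$; for $t\in\mathbb{Z}_{\ell^*}^\times$, $tI$ is the multiset $\{(ti)^{\mathrm{m}_I(i)}\}$. An element $t\in\mathbb{Z}_{\ell^*}^\times$ is a multiplier of $I$ if $tI=I+g$ for some $g\in G$; the multipliers form a subgroup of $\mathbb{Z}_{\ell^*}^\times$ (written multiplicatively). $\phi$ is Euler's totient function. For $s\in G$ and $K\le\mathbb{Z}_{\ell^*}^\times$, $sK=\{st: t\in K\}$ is the $K$-orbit of $s$, and $\alpha sK$ denotes the multiset in which each element of $sK$ has multiplicity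 $\alpha$; the union of such multisets over pairwise disjoint orbits $s_iK$ is the multiset whose multiplicity function is the sum of theirs. -}

module Defs where

open import Data.Nat using (NonZero; ≢-nonZero; ≢-nonZero⁻¹; ℕ; zero; suc; _+_; _*_; _∸_; _<_)
open import Data.Nat.DivMod using (_%_; m%n<n)
open import Data.Nat.GCD using (gcd)
open import Data.Nat.LCM using (lcm; lcm-least)
open import Data.Nat.Divisibility using (_∣_; 0∣⇒≡0; m∣m*n; n∣m*n)
open import Data.Nat.Properties using (m*n≢0)
open import Data.Fin as Fin using (Fin; toℕ; fromℕ<)
open import Data.List using (List; []; _∷_; map; concatMap; allFin; foldr; upTo; filter; length)
open import Data.Bool.ListAction using (any)
open import Data.Nat.ListAction using (sum)
open import Data.Product using (_×_; _,_; Σ; ∃)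
open import Data.Unit using (⊤; tt)
open import Data.Bool using (Bool; true; false; if_then_else_; _∧_)
open import Relation.Nullary using (Dec; yes; no; does)
open import Relation.Binary using (DecidableEquality)
open import Relation.Unary using (Pred; Decidable)
open import Relation.Binary.PropositionalEquality using (_≡_; _≢_; subst)
open import Data.Product.Properties using (≡-dec)
open import Level using (0ℓ)

-- The group G = ℤ_{ℓ₁} × ⋯ × ℤ_{ℓᵣ}.  The orders are given as a list
-- ks with ℓᵢ = suc kᵢ (so every ℓᵢ ≥ 1).  ℤ_ℓ is represented by Fin ℓ.

ℓs : List ℕ → List ℕ
ℓs = map suc

G : List ℕ → Set
G []       = ⊤
G (k ∷ ks) = Fin (suc k) × G ks

modF : ∀ {k} → ℕ → Fin (suc k)
modF {k} n = fromℕ< (m%n<n n (suc k))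

infixl 6 _⊕_
_⊕_ : ∀ {ks} → G ks → G ks → G ks
_⊕_ {[]}     _       _       = tt
_⊕_ {k ∷ ks} (a , x) (b , y) = modF (toℕ a + toℕ b) , (x ⊕ y)

⊖_ : ∀ {ks} → G ks → G ks
⊖_ {[]}     _       = tt
⊖_ {k ∷ ks} (a , x) = modF (suc k ∸ toℕ a) , (⊖ x)

infixl 7 _·_
_·_ : ∀ {ks} → ℕ → G ks → G ks
_·_ {[]}     n _       = tt
_·_ {k ∷ ks} n (a , x) = modF (n * toℕ a) , (n · x)

𝟘 : ∀ {ks} → G ks
𝟘 {[]}     = tt
𝟘 {k ∷ ks} = Fin.zero , 𝟘

_≟G_ : ∀ {ks} → DecidableEquality (G ks)
_≟G_ {[]}     tt tt = yes Relation.Binary.PropositionalEquality.refl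
_≟G_ {k ∷ ks} = ≡-dec Fin._≟_ _≟G_

allG : ∀ ks → List (G ks)
allG []       = tt ∷ []
allG (k ∷ ks) = concatMap (λ a → map (a ,_) (allG ks)) (allFin (suc k))

exponent : List ℕ → ℕ
exponent ks = foldr lcm 1 (ℓs ks)

lcm-nonZero : ∀ m n → .{{_ : NonZero m}} → .{{_ : NonZero n}} → NonZero (lcm m n)
lcm-nonZero m n = ≢-nonZero λ eq → ≢-nonZero⁻¹ (m * n) {{m*n≢0 m n}}
  (0∣⇒≡0 (subst (_∣ m * n) eq (lcm-least (m∣m*n {m} n) (n∣m*n m {n}))))

exponent-nonZero : ∀ ks → NonZero (exponent ks)
exponent-nonZero []       = _
exponent-nonZero (k ∷ ks) = lcm-nonZero (suc k) (exponent ks) {{_}} {{exponent-nonZero ks}}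

_mod*_ : ℕ → List ℕ → ℕ
n mod* ks = _%_ n (exponent ks) {{exponent-nonZero ks}}

-- Euler's totient: φ(n) = #{ t < n : gcd(t,n) = 1 }  (so φ(1) = 1)
φ : ℕ → ℕ
φ n = length (filter (λ t → gcd t n Data.Nat.≟ 1) (upTo n))

Multiset : List ℕ → Set
Multiset ks = G ks → ℕ

∣_∣ₘ : ∀ {ks} → Multiset ks → ℕ
∣_∣ₘ {ks} m = sum (map m (allG ks))

σ : ∀ {ks} → Multiset ks → G ks
σ {ks} m = foldr (λ g acc → (m g · g) ⊕ acc) 𝟘 (allG ks)

image : ∀ {ks} → (G ks → G ks) → Multiset ks → Multiset ks
image {ks} f m y = sum (map (λ x → if does (f x ≟G y) then m x else 0) (allG ks))

_+ₘ_ : ∀ {ks} → Multiset ks → G ks → Multiset ks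
I +ₘ g = image (λ x → x ⊕ g) I

_*ₘ_ : ∀ {ks} → ℕ → Multiset ks → Multiset ks
t *ₘ I = image (λ x → t · x) I

IsUnit : List ℕ → ℕ → Set
IsUnit ks t = t < exponent ks × gcd t (exponent ks) ≡ 1

IsMultiplier : ∀ {ks} → Multiset ks → ℕ → Set
IsMultiplier {ks} I t = IsUnit ks t × ∃ λ (g : G ks) → ∀ x → (t *ₘ I) x ≡ (I +ₘ g) x

record IsUnitSubgroup (ks : List ℕ) (K : Pred ℕ 0ℓ) : Set where
  field
    ⊆units : ∀ t → K t → IsUnit ks t
    one    : K (1 mod* ks)
    mul    : ∀ t u → K t → K u → K ((t * u) mod* ks)
    inv    : ∀ t → K t → ∃ λ u → K u × (t * u) mod* ks ≡ 1 mod* ks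

-- x ∈ sK  (decided by searching t < ℓ*; every element of K is < ℓ*)
inOrbit : ∀ {ks} (K : Pred ℕ 0ℓ) → Decidable K → G ks → G ks → Bool
inOrbit {ks} K K? s x = any (λ t → does (K? t) ∧ does ((t · s) ≟G x)) (upTo (exponent ks))

unionOrbits : ∀ {ks} (K : Pred ℕ 0ℓ) → Decidable K → (m : ℕ)
  → (Fin m → G ks) → (Fin m → ℕ) → Multiset ks
unionOrbits K K? m s α x =
  sum (map (λ j → if inOrbit K K? (s j) x then α j else 0) (allFin m))

{-# OPTIONS --safe #-}

-- Let n = |I| and ℓ* the exponent of G.  Comparing the sums of both sides of tI = I + g
-- shows that a multiplier t satisfies tσ = σ + n g.  As gcd(n, ℓ*) = 1, Euler's theorem
-- gives n^φ(ℓ*) ≡ 1 (mod ℓ*), so c = n^(φ(ℓ*)-1) σ satisfies tc = c + g, and then the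
-- translate J = I - c is fixed by every t ∈ K: m_J(tx) = m_J(x).  Such a multiset is
-- constant on the K-orbits, which partition G; choosing one representative sᵢ of each
-- orbit and αᵢ = m_J(sᵢ) gives J = α₁s₁K ∪ ⋯ ∪ αₘsₘK.

module Submission where

open import Defs
open import Algebra.Bundles using (AbelianGroup; CommutativeSemigroup)
open import Algebra.Structures using (IsCommutativeMonoid; IsAbelianGroup)
open import Data.Bool using (Bool; true; false; if_then_else_; T; _∧_)
open import Data.Bool.Properties using (T-≡; T-∧)
open import Data.Empty using (⊥-elim)
open import Data.Fin using (Fin; zero; suc; toℕ; fromℕ<)
open import Data.Fin.Permutation using (Permutation; permutation)
open import Data.Fin.Properties using (toℕ-injective; toℕ-fromℕ<; toℕ<n; suc-injective)
open import Data.List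
  using (List; []; _∷_; _++_; map; foldr; concatMap; allFin; tabulate; filter; length; applyUpTo; upTo; lookup; deduplicate)
open import Data.List.Membership.Propositional using (_∈_)
open import Data.List.Membership.Propositional.Properties
  using (∈-filter⁺; ∈-upTo⁺; ∈-lookup; ∈-allFin; ∈-map⁺; ∈-concatMap⁺)
open import Data.List.Properties using (map-tabulate; foldr-map; tabulate-lookup)
open import Data.List.Relation.Unary.All as All using (All; []; _∷_)
open import Data.List.Relation.Unary.AllPairs using (AllPairs; []; _∷_)
open import Data.List.Relation.Unary.Any as Any using (Any; here; there; satisfied)
open import Data.List.Relation.Unary.Any.Properties as Anyₚ using (any⁺; any⁻)
open import Data.List.Relation.Unary.Unique.DecSetoid.Properties using (deduplicate-!)
open import Data.Nat using (ℕ; zero; suc; pred; _+_; _*_; _∸_; _^_; _%_; _≟_; NonZero)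
open import Data.Nat.Coprimality using (Coprime; coprime-Bézout; gcd≡1⇒coprime; coprime⇒gcd≡1)
open import Data.Nat.DivMod
  using (m%n<n; n%n≡0; m%n%n≡m%n; %-distribˡ-+; %-distribˡ-*; [m+kn]%n≡m%n; m<n⇒m%n≡m; m∣n⇒o%n%m≡o%m)
open import Data.Nat.Divisibility using (_∣_; ∣-refl; ∣-trans; m∣m*n; ∣1⇒≡1; ∣n∣m%n⇒∣m; %-presˡ-∣)
open import Data.Nat.GCD using (gcd; module Bézout)
open import Data.Nat.LCM using (m∣lcm[m,n]; n∣lcm[m,n])
open import Data.Nat.ListAction using (sum)
open import Data.Nat.Properties
  using ( +-assoc; +-comm; *-assoc; *-comm; *-zeroʳ; *-identityˡ; *-distribˡ-+; *-distribʳ-+; suc-pred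
        ; *-commutativeSemigroup; *-1-commutativeMonoid; +-identityʳ; *-identityʳ; m+[n∸m]≡n; <⇒≤; +-0-isCommutativeMonoid)
open import Data.Nat.Tactic.RingSolver using (solve-∀)
open import Data.Product using (_×_; _,_; ∃; ∃₂; proj₁; proj₂)
open import Data.Unit using (tt)
open import Function using (_∘_; _⇔_; mk⇔; Equivalence)
open import Function.Properties.Equivalence using () renaming (trans to ⇔-trans; sym to ⇔-sym)
open import Level using (Level; 0ℓ)
open import Relation.Binary using (Rel; Setoid; DecSetoid; Symmetric)
open import Relation.Binary.PropositionalEquality
  using (_≡_; _≢_; refl; sym; trans; cong; cong₂; subst; isEquivalence; module ≡-Reasoning)
import Relation.Binary.Reasoning.Setoid as SetoidReasoning
open import Relation.Nullary using (¬_; Dec; yes; no; does)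
open import Relation.Nullary.Decidable using (does-⇔; dec-true; dec-false; T?)
open import Relation.Unary using (Pred; Decidable)

private
  variable
    ℓ₁ ℓ₂ ℓ₃ : Level
    A : Set ℓ₁
    B : Set ℓ₂
    C : Set ℓ₃

does⁺ : (A? : Dec A) → A → T (does A?)
does⁺ A? a = Equivalence.from T-≡ (dec-true A? a)

does⁻ : (A? : Dec A) → T (does A?) → A
does⁻ (yes a) _ = a

AllPairs-lookup : {R : Rel A ℓ₂} → Symmetric R → ∀ {xs} → AllPairs R xs
  → ∀ {i j} → i ≢ j → R (lookup xs i) (lookup xs j)
AllPairs-lookup R-sym (Rx ∷ Rxs) {zero}  {zero}  i≢j = ⊥-elim (i≢j refl)
AllPairs-lookup R-sym (Rx ∷ Rxs) {zero}  {suc j} _   = All.lookup Rx (∈-lookup j)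
AllPairs-lookup R-sym (Rx ∷ Rxs) {suc i} {zero}  _   = R-sym (All.lookup Rx (∈-lookup i))
AllPairs-lookup R-sym (Rx ∷ Rxs) {suc i} {suc j} i≢j = AllPairs-lookup R-sym Rxs (i≢j ∘ cong suc)

module ListSum (_∙_ : A → A → A) (ε : A) where

  ∑ : List B → (B → A) → A
  ∑ xs F = foldr (λ x → F x ∙_) ε xs

∑-homo : {_∙_ : A → A → A} {ε : A} {_∘′_ : C → C → C} {ε′ : C} (h : A → C)
  → (∀ x y → h (x ∙ y) ≡ h x ∘′ h y) → h ε ≡ ε′
  → ∀ xs (F : B → A) → h (ListSum.∑ _∙_ ε xs F) ≡ ListSum.∑ _∘′_ ε′ xs (h ∘ F)
∑-homo h h-∙ h-ε []       F = h-ε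
∑-homo {_∙_ = _∙_} {ε} {_∘′_} {ε′} h h-∙ h-ε (x ∷ xs) F =
  trans (h-∙ _ _) (cong (h (F x) ∘′_) (∑-homo {_∙_ = _∙_} {ε} {_∘′_} {ε′} h h-∙ h-ε xs F))

module ListSumProperties {_∙_ : A → A → A} {ε : A} (isCM : IsCommutativeMonoid _≡_ _∙_ ε) where

  open IsCommutativeMonoid isCM using (assoc; identityˡ; identityʳ; isCommutativeSemigroup)

  commutativeSemigroup : CommutativeSemigroup _ _
  commutativeSemigroup = record { isCommutativeSemigroup = isCommutativeSemigroup }

  open import Algebra.Properties.CommutativeSemigroup commutativeSemigroup using (interchange)
  open ListSum _∙_ ε public

  ∑-cong : (xs : List B) {F F′ : B → A} → (∀ x → F x ≡ F′ x) → ∑ xs F ≡ ∑ xs F′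
  ∑-cong []       F≗F′ = refl
  ∑-cong (x ∷ xs) F≗F′ = cong₂ _∙_ (F≗F′ x) (∑-cong xs F≗F′)

  ∑-ε : {xs : List B} {F : B → A} → All (λ x → F x ≡ ε) xs → ∑ xs F ≡ ε
  ∑-ε []             = refl
  ∑-ε (Fx≡ε ∷ F≗ε) = trans (cong₂ _∙_ Fx≡ε (∑-ε F≗ε)) (identityˡ ε)

  ∑-++ : (xs ys : List B) (F : B → A) → ∑ (xs ++ ys) F ≡ ∑ xs F ∙ ∑ ys F
  ∑-++ []       ys F = sym (identityˡ _)
  ∑-++ (x ∷ xs) ys F = trans (cong (F x ∙_) (∑-++ xs ys F)) (sym (assoc _ _ _))

  ∑-map : (f : B → C) (xs : List B) (F : C → A)
    → ∑ (map f xs) F ≡ ∑ xs (F ∘ f)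
  ∑-map f []       F = refl
  ∑-map f (x ∷ xs) F = cong (F (f x) ∙_) (∑-map f xs F)

  ∑-concatMap : (f : B → List C) (xs : List B) (F : C → A)
    → ∑ (concatMap f xs) F ≡ ∑ xs (λ x → ∑ (f x) F)
  ∑-concatMap f []       F = refl
  ∑-concatMap f (x ∷ xs) F =
    trans (∑-++ (f x) (concatMap f xs) F) (cong (∑ (f x) F ∙_) (∑-concatMap f xs F))

  ∑-distrib : (xs : List B) (F F′ : B → A)
    → ∑ xs (λ x → F x ∙ F′ x) ≡ ∑ xs F ∙ ∑ xs F′
  ∑-distrib []       F F′ = sym (identityˡ ε)
  ∑-distrib (x ∷ xs) F F′ = trans (cong ((F x ∙ F′ x) ∙_) (∑-distrib xs F F′)) (interchange _ _ _ _)

  ∑-comm : (xs : List B) (ys : List C) (F : B → C → A)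
    → ∑ xs (λ x → ∑ ys (F x)) ≡ ∑ ys (λ y → ∑ xs (λ x → F x y))
  ∑-comm []       ys F = sym (∑-ε (All.universal (λ _ → refl) ys))
  ∑-comm (x ∷ xs) ys F =
    trans (cong (∑ ys (F x) ∙_) (∑-comm xs ys F))
          (sym (∑-distrib ys (F x) (λ y → ∑ xs (λ x → F x y))))

  ∑-allFin-δ : ∀ n (F : Fin n → A) (i : Fin n)
    → (∀ j → j ≢ i → F j ≡ ε) → ∑ (allFin n) F ≡ F i
  ∑-allFin-δ (suc n) F i F≗ε = trans (cong (F zero ∙_) ∑-tail) (δ-at i F≗ε)
    where
    ∑-tail : ∑ (tabulate {n = n} suc) F ≡ ∑ (allFin n) (F ∘ suc)
    ∑-tail = trans (cong (λ ys → ∑ ys F) (sym (map-tabulate (λ j → j) suc))) (∑-map suc (allFin n) F)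
    δ-at : ∀ i → (∀ j → j ≢ i → F j ≡ ε) → F zero ∙ ∑ (allFin n) (F ∘ suc) ≡ F i
    δ-at zero    F≗ε =
      trans (cong (F zero ∙_) (∑-ε (All.universal (λ j → F≗ε (suc j) λ ()) (allFin n)))) (identityʳ _)
    δ-at (suc i) F≗ε = trans (cong₂ _∙_ (F≗ε zero λ ())
      (∑-allFin-δ n (F ∘ suc) i (λ j j≢i → F≗ε (suc j) (j≢i ∘ suc-injective))))
      (identityˡ _)

  ∑-allG-δ : ∀ ks (F : G ks → A) (y : G ks) → (∀ x → x ≢ y → F x ≡ ε) → ∑ (allG ks) F ≡ F y
  ∑-allG-δ []       F tt     F≗ε = identityʳ _
  ∑-allG-δ (k ∷ ks) F (a , y) F≗ε = begin
    ∑ (concatMap (λ b → map (b ,_) (allG ks)) (allFin (suc k))) F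
      ≡⟨ ∑-concatMap (λ b → map (b ,_) (allG ks)) (allFin (suc k)) F ⟩
    ∑ (allFin (suc k)) (λ b → ∑ (map (b ,_) (allG ks)) F)
      ≡⟨ ∑-cong (allFin (suc k)) (λ b → ∑-map (b ,_) (allG ks) F) ⟩
    ∑ (allFin (suc k)) (λ b → ∑ (allG ks) (λ x → F (b , x)))
      ≡⟨ ∑-allFin-δ (suc k) _ a (λ b b≢a →
           ∑-ε (All.universal (λ x → F≗ε (b , x) (b≢a ∘ cong proj₁)) (allG ks))) ⟩
    ∑ (allG ks) (λ x → F (a , x))
      ≡⟨ ∑-allG-δ ks (λ x → F (a , x)) y (λ x x≢y → F≗ε (a , x) (x≢y ∘ cong proj₂)) ⟩
    F (a , y) ∎
    where open ≡-Reasoning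

module Congruence (N : ℕ) .{{_ : NonZero N}} where

  infix 4 _≈_
  record _≈_ (a b : ℕ) : Set where
    constructor %≡⇒≈
    field
      ≈⇒%≡ : a % N ≡ b % N
  open _≈_ public

  ≈-refl : ∀ {a} → a ≈ a
  ≈-refl = %≡⇒≈ refl

  ≈-sym : ∀ {a b} → a ≈ b → b ≈ a
  ≈-sym (%≡⇒≈ a≈b) = %≡⇒≈ (sym a≈b)

  ≈-trans : ∀ {a b c} → a ≈ b → b ≈ c → a ≈ c
  ≈-trans (%≡⇒≈ a≈b) (%≡⇒≈ b≈c) = %≡⇒≈ (trans a≈b b≈c)

  ≈-reflexive : ∀ {a b} → a ≡ b → a ≈ b
  ≈-reflexive refl = ≈-refl

  ≈-setoid : Setoid 0ℓ 0ℓ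
  ≈-setoid = record
    { _≈_ = _≈_
    ; isEquivalence = record { refl = ≈-refl ; sym = ≈-sym ; trans = ≈-trans }
    }

  module ≈-Reasoning = SetoidReasoning ≈-setoid

  %-≈ : ∀ a → a % N ≈ a
  %-≈ a = %≡⇒≈ (m%n%n≡m%n a N)

  +-multiple-≈ : ∀ a k → a + k * N ≈ a
  +-multiple-≈ a k = %≡⇒≈ ([m+kn]%n≡m%n a k N)

  +-cong-≈ : ∀ {a b c d} → a ≈ b → c ≈ d → a + c ≈ b + d
  +-cong-≈ {a} {b} {c} {d} (%≡⇒≈ a≈b) (%≡⇒≈ c≈d) = %≡⇒≈ (begin
    (a + c) % N             ≡⟨ %-distribˡ-+ a c N ⟩
    (a % N + c % N) % N     ≡⟨ cong₂ (λ u v → (u + v) % N) a≈b c≈d ⟩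
    (b % N + d % N) % N     ≡⟨ %-distribˡ-+ b d N ⟨
    (b + d) % N             ∎)
    where open ≡-Reasoning

  *-cong-≈ : ∀ {a b c d} → a ≈ b → c ≈ d → a * c ≈ b * d
  *-cong-≈ {a} {b} {c} {d} (%≡⇒≈ a≈b) (%≡⇒≈ c≈d) = %≡⇒≈ (begin
    (a * c) % N             ≡⟨ %-distribˡ-* a c N ⟩
    (a % N * (c % N)) % N   ≡⟨ cong₂ (λ u v → (u * v) % N) a≈b c≈d ⟩
    (b % N * (d % N)) % N   ≡⟨ %-distribˡ-* b d N ⟨
    (b * d) % N             ∎)
    where open ≡-Reasoning

  -- Defs' modF {k} is definitionally residue (suc k).
  residue : ℕ → Fin N
  residue a = fromℕ< (m%n<n a N)

  toℕ-residue : ∀ a → toℕ (residue a) ≈ a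
  toℕ-residue a = %≡⇒≈ (trans (cong (_% N) (toℕ-fromℕ< (m%n<n a N))) (m%n%n≡m%n a N))

  residue-≈ : ∀ {a} {i : Fin N} → a ≈ toℕ i → residue a ≡ i
  residue-≈ {a} {i} (%≡⇒≈ a≈i) =
    toℕ-injective (trans (toℕ-fromℕ< (m%n<n a N)) (trans a≈i (m<n⇒m%n≡m (toℕ<n i))))

  residue-cong : ∀ {a b} → a ≈ b → residue a ≡ residue b
  residue-cong {a} {b} a≈b = residue-≈ (≈-trans a≈b (≈-sym (toℕ-residue b)))

  record Invertible (a : ℕ) : Set where
    constructor withInverse
    field
      inverse   : ℕ
      *-inverse : a * inverse ≈ 1

  invertible-resp-≈ : ∀ {a b} → a ≈ b → Invertible a → Invertible b
  invertible-resp-≈ a≈b (withInverse c ac≈1) =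
    withInverse c (≈-trans (*-cong-≈ (≈-sym a≈b) ≈-refl) ac≈1)

  invertible-* : ∀ {a b} → Invertible a → Invertible b → Invertible (a * b)
  invertible-* {a} {b} (withInverse a′ aa′≈1) (withInverse b′ bb′≈1) =
    withInverse (a′ * b′) (begin
    a * b * (a′ * b′)  ≡⟨ interchange a b a′ b′ ⟩
    a * a′ * (b * b′)  ≈⟨ *-cong-≈ aa′≈1 bb′≈1 ⟩
    1                  ∎)
    where open ≈-Reasoning
          open import Algebra.Properties.CommutativeSemigroup *-commutativeSemigroup using (interchange)

  invertible-*⁻ʳ : ∀ {a b} → Invertible (a * b) → Invertible b
  invertible-*⁻ʳ {a} {b} (withInverse c abc≈1) = withInverse (a * c) (begin
    b * (a * c)  ≡⟨ x∙yz≈y∙xz b a c ⟩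
    a * (b * c)  ≡⟨ *-assoc a b c ⟨
    a * b * c    ≈⟨ abc≈1 ⟩
    1            ∎)
    where
    open ≈-Reasoning
    open import Algebra.Properties.CommutativeSemigroup *-commutativeSemigroup using (x∙yz≈y∙xz)

  *-cancelˡ-≈ : ∀ {a x y} → Invertible a → a * x ≈ a * y → x ≈ y
  *-cancelˡ-≈ {a} {x} {y} (withInverse b ab≈1) ax≈ay = begin
    x            ≡⟨ *-identityˡ x ⟨
    1 * x        ≈⟨ *-cong-≈ ab≈1 ≈-refl ⟨
    a * b * x    ≡⟨ cong (_* x) (*-comm a b) ⟩
    b * a * x    ≡⟨ *-assoc b a x ⟩
    b * (a * x)  ≈⟨ *-cong-≈ (≈-refl {b}) ax≈ay ⟩
    b * (a * y)  ≡⟨ *-assoc b a y ⟨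
    b * a * y    ≡⟨ cong (_* y) (*-comm b a) ⟩
    a * b * y    ≈⟨ *-cong-≈ ab≈1 ≈-refl ⟩
    1 * y        ≡⟨ *-identityˡ y ⟩
    y            ∎
    where open ≈-Reasoning

  coprime⇒invertible : ∀ {a} → Coprime a N → Invertible a
  coprime⇒invertible {a} coprime with coprime-Bézout coprime
  ... | Bézout.+- x y 1+yN≡xa = withInverse x (begin
    a * x      ≡⟨ *-comm a x ⟩
    x * a      ≡⟨ 1+yN≡xa ⟨
    1 + y * N  ≈⟨ +-multiple-≈ 1 y ⟩
    1          ∎)
    where open ≈-Reasoning
  -- Here x a ≡ -1, so x (N - 1) inverts a.
  ... | Bézout.-+ x y 1+xa≡yN = withInverse (x * pred N) (begin
    a * (x * pred N)                  ≈⟨ +-multiple-≈ _ y ⟨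
    a * (x * pred N) + y * N          ≡⟨ cong (a * (x * pred N) +_) 1+xa≡yN ⟨
    a * (x * pred N) + (1 + x * a)    ≡⟨ identity a x (pred N) ⟩
    1 + x * a * suc (pred N)          ≡⟨ cong (λ n → 1 + x * a * n) (suc-pred N) ⟩
    1 + x * a * N                     ≈⟨ +-multiple-≈ 1 (x * a) ⟩
    1                                 ∎)
    where
    open ≈-Reasoning
    identity : ∀ a x p → a * (x * p) + (1 + x * a) ≡ 1 + x * a * (1 + p)
    identity = solve-∀

  invertible⇒coprime : ∀ {a} → Invertible a → Coprime a N
  invertible⇒coprime {a} (withInverse b ab≈1) (d∣a , d∣N) =
    ∣1⇒≡1 (∣n∣m%n⇒∣m d∣N (subst (_ ∣_) (≈⇒%≡ ab≈1) (%-presˡ-∣ (∣-trans d∣a (m∣m*n b)) d∣N)))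

  gcd≡1⇔invertible : ∀ a → gcd a N ≡ 1 ⇔ Invertible a
  gcd≡1⇔invertible a =
    mk⇔ (coprime⇒invertible {a} ∘ gcd≡1⇒coprime) (coprime⇒gcd≡1 ∘ invertible⇒coprime {a})

module Euler (N : ℕ) .{{_ : NonZero N}} where

  open Congruence N
  open ListSum _*_ 1 renaming (∑ to ∏)
  open import Algebra.Properties.CommutativeMonoid.Sum *-1-commutativeMonoid
    using (sum-permute; ∑-distrib-+) renaming (sum to ∏ᶠ)

  isUnit : ℕ → Bool
  isUnit t = does (gcd t N ≟ 1)

  isUnit-resp : ∀ {a b} → Invertible a ⇔ Invertible b → isUnit a ≡ isUnit b
  isUnit-resp {a} {b} a⇔b = does-⇔ a-unit⇔b-unit (gcd a N ≟ 1) (gcd b N ≟ 1)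
    where
    a-unit⇔b-unit : gcd a N ≡ 1 ⇔ gcd b N ≡ 1
    a-unit⇔b-unit = ⇔-trans (gcd≡1⇔invertible a) (⇔-trans a⇔b (⇔-sym (gcd≡1⇔invertible b)))

  unitPart : ℕ → ℕ
  unitPart t = if isUnit t then t else 1

  unitPart-invertible : ∀ t → Invertible (unitPart t)
  unitPart-invertible t = invertible (gcd t N ≟ 1)
    where
    invertible : (unit? : Dec (gcd t N ≡ 1)) → Invertible (if does unit? then t else 1)
    invertible (yes gcd≡1) = Equivalence.to (gcd≡1⇔invertible t) gcd≡1
    invertible (no _)      = withInverse 1 ≈-refl

  unitFactor : ℕ → ℕ → ℕ
  unitFactor n t = if isUnit t then n else 1

  unitPart-* : ∀ {n} → Invertible n → ∀ t
    → unitPart (toℕ (residue (n * t))) ≈ unitFactor n t * unitPart t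
  unitPart-* {n} n-inv t =
    subst (λ u → (if u then r else 1) ≈ unitFactor n t * unitPart t) (sym same-unit) (select (isUnit t))
    where
    r = toℕ (residue (n * t))
    r≈nt : r ≈ n * t
    r≈nt = toℕ-residue (n * t)
    same-unit : isUnit r ≡ isUnit t
    same-unit = isUnit-resp (mk⇔ (invertible-*⁻ʳ {n} ∘ invertible-resp-≈ r≈nt)
                                 (invertible-resp-≈ (≈-sym r≈nt) ∘ invertible-* n-inv))
    select : ∀ u → (if u then r else 1) ≈ (if u then n else 1) * (if u then t else 1)
    select true  = r≈nt
    select false = ≈-refl

  ∏-unitFactor : ∀ n xs → ∏ xs (unitFactor n) ≡ n ^ length (filter (λ t → gcd t N ≟ 1) xs)
  ∏-unitFactor n []       = refl
  ∏-unitFactor n (x ∷ xs) with does (gcd x N ≟ 1)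
  ... | true  = cong (n *_) (∏-unitFactor n xs)
  ... | false = trans (+-identityʳ _) (∏-unitFactor n xs)

  ∏ᶠ-applyUpTo : ∀ m (f g : ℕ → ℕ) → ∏ᶠ {m} (λ i → f (g (toℕ i))) ≡ ∏ (applyUpTo g m) f
  ∏ᶠ-applyUpTo zero    f g = refl
  ∏ᶠ-applyUpTo (suc m) f g = cong (f (g 0) *_) (∏ᶠ-applyUpTo m f (g ∘ suc))

  ∏ᶠ-cong-≈ : ∀ {m} {f g : Fin m → ℕ} → (∀ i → f i ≈ g i) → ∏ᶠ f ≈ ∏ᶠ g
  ∏ᶠ-cong-≈ {zero}  f≈g = ≈-refl
  ∏ᶠ-cong-≈ {suc m} f≈g = *-cong-≈ (f≈g zero) (∏ᶠ-cong-≈ (f≈g ∘ suc))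

  ∏ᶠ-invertible : ∀ {m} {f : Fin m → ℕ} → (∀ i → Invertible (f i)) → Invertible (∏ᶠ f)
  ∏ᶠ-invertible {zero}  f-inv = withInverse 1 ≈-refl
  ∏ᶠ-invertible {suc m} f-inv = invertible-* (f-inv zero) (∏ᶠ-invertible (f-inv ∘ suc))

  multiplyBy : ∀ {n} → Invertible n → Permutation N N
  multiplyBy {n} (withInverse b nb≈1) =
    permutation (times n) (times b) (cancel n b nb≈1) (cancel b n (subst (_≈ 1) (*-comm n b) nb≈1))
    where
    times : ℕ → Fin N → Fin N
    times a i = residue (a * toℕ i)
    cancel : ∀ a c → a * c ≈ 1 → ∀ i → times a (times c i) ≡ i
    cancel a c ac≈1 i = residue-≈ (begin
      a * toℕ (residue (c * toℕ i))  ≈⟨ *-cong-≈ (≈-refl {a}) (toℕ-residue (c * toℕ i)) ⟩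
      a * (c * toℕ i)                ≡⟨ *-assoc a c (toℕ i) ⟨
      a * c * toℕ i                  ≈⟨ *-cong-≈ ac≈1 ≈-refl ⟩
      1 * toℕ i                      ≡⟨ *-identityˡ (toℕ i) ⟩
      toℕ i                          ∎)
      where open ≈-Reasoning

  -- Multiplication by n permutes the residues and preserves units, so the product U of
  -- the units satisfies U n^φ(N) ≡ U, and U is itself a unit.
  euler : ∀ {n} → gcd n N ≡ 1 → n ^ φ N ≈ 1
  euler {n} gcd≡1 = *-cancelˡ-≈ {U} (∏ᶠ-invertible {N} (unitPart-invertible ∘ toℕ)) (begin
    U * n ^ φ N
      ≡⟨ *-comm U (n ^ φ N) ⟩
    n ^ φ N * U
      ≡⟨ cong (_* U) n^φ≡∏ᶠ ⟩
    ∏ᶠ {N} (unitFactor n ∘ toℕ) * U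
      ≡⟨ ∑-distrib-+ {N} (unitFactor n ∘ toℕ) (unitPart ∘ toℕ) ⟨
    ∏ᶠ {N} (λ i → unitFactor n (toℕ i) * unitPart (toℕ i))
      ≈⟨ ∏ᶠ-cong-≈ {N} (unitPart-* n-inv ∘ toℕ) ⟨
    ∏ᶠ {N} (λ i → unitPart (toℕ (residue (n * toℕ i))))
      ≡⟨ sum-permute (unitPart ∘ toℕ) (multiplyBy n-inv) ⟨
    U
      ≡⟨ *-identityʳ U ⟨
    U * 1 ∎)
    where
    open ≈-Reasoning
    n-inv : Invertible n
    n-inv = Equivalence.to (gcd≡1⇔invertible n) gcd≡1
    U : ℕ
    U = ∏ᶠ {N} (unitPart ∘ toℕ)
    n^φ≡∏ᶠ : n ^ φ N ≡ ∏ᶠ {N} (unitFactor n ∘ toℕ)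
    n^φ≡∏ᶠ = sym (trans (∏ᶠ-applyUpTo N (unitFactor n) (λ t → t)) (∏-unitFactor n (upTo N)))

  -- 1 % N is a unit below N (it is 0 when N = 1).
  φ-nonZero : NonZero (φ N)
  φ-nonZero = length-nonZero (∈-filter⁺ (λ t → gcd t N ≟ 1) (∈-upTo⁺ (m%n<n 1 N)) gcd[1%N,N]≡1)
    where
    gcd[1%N,N]≡1 : gcd (1 % N) N ≡ 1
    gcd[1%N,N]≡1 = Equivalence.from (gcd≡1⇔invertible (1 % N))
      (withInverse 1 (subst (_≈ 1) (sym (*-identityʳ (1 % N))) (%-≈ 1)))
    length-nonZero : ∀ {x : ℕ} {xs} → x ∈ xs → NonZero (length xs)
    length-nonZero (here _)  = _
    length-nonZero (there _) = _

⊕-assoc : ∀ {ks} (x y z : G ks) → (x ⊕ y) ⊕ z ≡ x ⊕ (y ⊕ z)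
⊕-assoc {[]}     _       _       _       = refl
⊕-assoc {k ∷ ks} (a , x) (b , y) (c , z) = cong₂ _,_ (residue-cong (begin
  toℕ (residue (toℕ a + toℕ b)) + toℕ c  ≈⟨ +-cong-≈ (toℕ-residue (toℕ a + toℕ b)) ≈-refl ⟩
  toℕ a + toℕ b + toℕ c                  ≡⟨ +-assoc (toℕ a) (toℕ b) (toℕ c) ⟩
  toℕ a + (toℕ b + toℕ c)                ≈⟨ +-cong-≈ ≈-refl (toℕ-residue (toℕ b + toℕ c)) ⟨
  toℕ a + toℕ (residue (toℕ b + toℕ c))  ∎)) (⊕-assoc x y z)
  where
  open Congruence (suc k)
  open ≈-Reasoning

⊕-comm : ∀ {ks} (x y : G ks) → x ⊕ y ≡ y ⊕ x
⊕-comm {[]}     _       _       = refl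
⊕-comm {k ∷ ks} (a , x) (b , y) = cong₂ _,_ (cong modF (+-comm (toℕ a) (toℕ b))) (⊕-comm x y)

⊕-identityˡ : ∀ {ks} (x : G ks) → 𝟘 ⊕ x ≡ x
⊕-identityˡ {[]}     _       = refl
⊕-identityˡ {k ∷ ks} (a , x) = cong₂ _,_ (residue-≈ ≈-refl) (⊕-identityˡ x)
  where open Congruence (suc k)

⊕-inverseʳ : ∀ {ks} (x : G ks) → x ⊕ ⊖ x ≡ 𝟘
⊕-inverseʳ {[]}     _       = refl
⊕-inverseʳ {k ∷ ks} (a , x) = cong₂ _,_ (residue-≈ (begin
  toℕ a + toℕ (residue (suc k ∸ toℕ a))  ≈⟨ +-cong-≈ ≈-refl (toℕ-residue (suc k ∸ toℕ a)) ⟩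
  toℕ a + (suc k ∸ toℕ a)                ≡⟨ m+[n∸m]≡n (<⇒≤ (toℕ<n a)) ⟩
  suc k                                  ≈⟨ %≡⇒≈ (n%n≡0 (suc k)) ⟩
  0                                      ∎)) (⊕-inverseʳ x)
  where
  open Congruence (suc k)
  open ≈-Reasoning

⊕-isAbelianGroup : ∀ ks → IsAbelianGroup _≡_ (_⊕_ {ks}) 𝟘 ⊖_
⊕-isAbelianGroup ks = record
  { isGroup = record
    { isMonoid = record
      { isSemigroup = record
        { isMagma = record { isEquivalence = isEquivalence ; ∙-cong = cong₂ _⊕_ }
        ; assoc = ⊕-assoc
        }
      ; identity = ⊕-identityˡ , λ x → trans (⊕-comm x 𝟘) (⊕-identityˡ x)
      }
    ; inverse = (λ x → trans (⊕-comm (⊖ x) x) (⊕-inverseʳ x)) , ⊕-inverseʳ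
    ; ⁻¹-cong = cong ⊖_
    }
  ; comm = ⊕-comm
  }

G-abelianGroup : List ℕ → AbelianGroup 0ℓ 0ℓ
G-abelianGroup ks = record { isAbelianGroup = ⊕-isAbelianGroup ks }

·-distribˡ-⊕ : ∀ {ks} t (x y : G ks) → t · (x ⊕ y) ≡ t · x ⊕ t · y
·-distribˡ-⊕ {[]}     t _       _       = refl
·-distribˡ-⊕ {k ∷ ks} t (a , x) (b , y) = cong₂ _,_ (residue-cong (begin
  t * toℕ (residue (toℕ a + toℕ b))
    ≈⟨ *-cong-≈ (≈-refl {t}) (toℕ-residue (toℕ a + toℕ b)) ⟩
  t * (toℕ a + toℕ b)
    ≡⟨ *-distribˡ-+ t (toℕ a) (toℕ b) ⟩
  t * toℕ a + t * toℕ b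
    ≈⟨ +-cong-≈ (toℕ-residue (t * toℕ a)) (toℕ-residue (t * toℕ b)) ⟨
  toℕ (residue (t * toℕ a)) + toℕ (residue (t * toℕ b)) ∎)) (·-distribˡ-⊕ t x y)
  where
  open Congruence (suc k)
  open ≈-Reasoning

·-distribʳ-+ : ∀ {ks} m n (x : G ks) → (m + n) · x ≡ m · x ⊕ n · x
·-distribʳ-+ {[]}     m n _       = refl
·-distribʳ-+ {k ∷ ks} m n (c , x) = cong₂ _,_ (residue-cong (begin
  (m + n) * toℕ c
    ≡⟨ *-distribʳ-+ (toℕ c) m n ⟩
  m * toℕ c + n * toℕ c
    ≈⟨ +-cong-≈ (toℕ-residue (m * toℕ c)) (toℕ-residue (n * toℕ c)) ⟨
  toℕ (residue (m * toℕ c)) + toℕ (residue (n * toℕ c)) ∎)) (·-distribʳ-+ m n x)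
  where
  open Congruence (suc k)
  open ≈-Reasoning

·-zeroˡ : ∀ {ks} (x : G ks) → 0 · x ≡ 𝟘
·-zeroˡ {[]}     _       = refl
·-zeroˡ {k ∷ ks} (c , x) = cong₂ _,_ (residue-≈ ≈-refl) (·-zeroˡ x)
  where open Congruence (suc k)

·-zeroʳ : ∀ {ks} t → t · 𝟘 {ks} ≡ 𝟘
·-zeroʳ {[]}     t = refl
·-zeroʳ {k ∷ ks} t = cong₂ _,_ (residue-≈ (≈-reflexive (*-zeroʳ t))) (·-zeroʳ t)
  where open Congruence (suc k)

·-identityˡ : ∀ {ks} (x : G ks) → 1 · x ≡ x
·-identityˡ {[]}     _       = refl
·-identityˡ {k ∷ ks} (c , x) =
  cong₂ _,_ (residue-≈ (≈-reflexive (*-identityˡ (toℕ c)))) (·-identityˡ x)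
  where open Congruence (suc k)

*-·-assoc : ∀ {ks} m n (x : G ks) → (m * n) · x ≡ m · (n · x)
*-·-assoc {[]}     m n _       = refl
*-·-assoc {k ∷ ks} m n (c , x) = cong₂ _,_ (residue-cong (begin
  m * n * toℕ c                  ≡⟨ *-assoc m n (toℕ c) ⟩
  m * (n * toℕ c)                ≈⟨ *-cong-≈ (≈-refl {m}) (toℕ-residue (n * toℕ c)) ⟨
  m * toℕ (residue (n * toℕ c))  ∎)) (*-·-assoc m n x)
  where
  open Congruence (suc k)
  open ≈-Reasoning

%-· : ∀ {ks} E .{{_ : NonZero E}} → exponent ks ∣ E → ∀ j (x : G ks) → (j % E) · x ≡ j · x
%-· {[]}     E ℓ*∣E j _       = refl
%-· {k ∷ ks} E ℓ*∣E j (c , x) =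
  cong₂ _,_ (residue-cong (*-cong-≈ {j % E} {j} (%≡⇒≈ (m∣n⇒o%n%m≡o%m (suc k) E j ℓ∣E)) ≈-refl))
            (%-· E (∣-trans (n∣lcm[m,n] (suc k) (exponent ks)) ℓ*∣E) j x)
  where
  open Congruence (suc k)
  ℓ∣E : suc k ∣ E
  ℓ∣E = ∣-trans (m∣lcm[m,n] (suc k) (exponent ks)) ℓ*∣E

≈-exponent⇒· : ∀ {ks m n} → Congruence._≈_ (exponent ks) {{exponent-nonZero ks}} m n
  → (x : G ks) → m · x ≡ n · x
≈-exponent⇒· {ks} {m} {n} (Congruence.%≡⇒≈ m≈n) x = begin
  m · x            ≡⟨ %-· ℓ* ∣-refl m x ⟨
  (m % ℓ*) · x     ≡⟨ cong (_· x) m≈n ⟩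
  (n % ℓ*) · x     ≡⟨ %-· ℓ* ∣-refl n x ⟩
  n · x            ∎
  where
  open ≡-Reasoning
  ℓ* = exponent ks
  instance _ = exponent-nonZero ks

∈-allG : ∀ ks (x : G ks) → x ∈ allG ks
∈-allG []       tt      = here refl
∈-allG (k ∷ ks) (a , x) =
  ∈-concatMap⁺ (λ b → map (b ,_) (allG ks))
    (Any.map (λ { refl → ∈-map⁺ (a ,_) (∈-allG ks x) }) (∈-allFin a))

module ℕ-Sum = ListSumProperties +-0-isCommutativeMonoid
module G-Sum {ks : List ℕ} = ListSumProperties (IsAbelianGroup.isCommutativeMonoid (⊕-isAbelianGroup ks))

open ℕ-Sum using () renaming (∑ to ∑ℕ)
open G-Sum using () renaming (∑ to ∑G)

sum-map : (xs : List B) (F : B → ℕ) → sum (map F xs) ≡ ∑ℕ xs F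
sum-map xs F = foldr-map _+_ F 0 xs

∑ℕ-· : ∀ {ks} (xs : List B) (F : B → ℕ) (g : G ks) → ∑ℕ xs F · g ≡ ∑G xs (λ x → F x · g)
∑ℕ-· xs F g = ∑-homo {_∘′_ = _⊕_} (_· g) (λ m n → ·-distribʳ-+ m n g) (·-zeroˡ g) xs F

·-∑G : ∀ {ks} t (xs : List B) (F : B → G ks) → t · ∑G xs F ≡ ∑G xs (λ x → t · F x)
·-∑G t xs F = ∑-homo {_∘′_ = _⊕_} (t ·_) (·-distribˡ-⊕ t) (·-zeroʳ t) xs F

∣∣ₘ-· : ∀ {ks} (I : Multiset ks) (g : G ks) → ∣ I ∣ₘ · g ≡ ∑G (allG ks) (λ x → I x · g)
∣∣ₘ-· {ks} I g = trans (cong (_· g) (sum-map (allG ks) I)) (∑ℕ-· (allG ks) I g)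

image-unique-preimage : ∀ {ks} (f : G ks → G ks) (I : Multiset ks) {x₀ y}
  → f x₀ ≡ y → (∀ x → f x ≡ y → x ≡ x₀) → image f I y ≡ I x₀
image-unique-preimage {ks} f I {x₀} {y} fx₀≡y unique = begin
  image f I y         ≡⟨ sum-map (allG ks) δ ⟩
  ∑ℕ (allG ks) δ      ≡⟨ ℕ-Sum.∑-allG-δ ks δ x₀ δ-off-x₀ ⟩
  δ x₀                ≡⟨ cong (if_then I x₀ else 0) (dec-true (f x₀ ≟G y) fx₀≡y) ⟩
  I x₀                ∎
  where
  open ≡-Reasoning
  δ : G ks → ℕ
  δ x = if does (f x ≟G y) then I x else 0
  δ-off-x₀ : ∀ x → x ≢ x₀ → δ x ≡ 0
  δ-off-x₀ x x≢x₀ = cong (if_then I x else 0) (dec-false (f x ≟G y) (x≢x₀ ∘ unique x))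

+ₘ-apply : ∀ {ks} (I : Multiset ks) (g z : G ks) → (I +ₘ g) z ≡ I (z ⊕ ⊖ g)
+ₘ-apply {ks} I g z = image-unique-preimage (_⊕ g) I (//-rightDividesˡ g z)
  (λ x x⊕g≡z → trans (sym (//-rightDividesʳ g x)) (cong (_⊕ ⊖ g) x⊕g≡z))
  where
  open import Algebra.Properties.AbelianGroup (G-abelianGroup ks) using (//-rightDividesˡ; //-rightDividesʳ)

*ₘ-apply : ∀ {ks} t (I : Multiset ks) → (∀ x y → t · x ≡ t · y → x ≡ y)
  → ∀ y → (t *ₘ I) (t · y) ≡ I y
*ₘ-apply t I t·-injective y = image-unique-preimage (t ·_) I refl (λ x → t·-injective x y)

σ-cong : ∀ {ks} {I J : Multiset ks} → (∀ x → I x ≡ J x) → σ I ≡ σ J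
σ-cong {ks} I≗J = G-Sum.∑-cong (allG ks) (λ x → cong (_· x) (I≗J x))

σ-image : ∀ {ks} (f : G ks → G ks) (I : Multiset ks)
  → σ (image f I) ≡ ∑G (allG ks) (λ x → I x · f x)
σ-image {ks} f I = begin
  ∑G (allG ks) (λ y → image f I y · y)
    ≡⟨ G-Sum.∑-cong (allG ks) (λ y → cong (_· y) (sum-map (allG ks) (λ x → δ x y))) ⟩
  ∑G (allG ks) (λ y → ∑ℕ (allG ks) (λ x → δ x y) · y)
    ≡⟨ G-Sum.∑-cong (allG ks) (λ y → ∑ℕ-· (allG ks) (λ x → δ x y) y) ⟩
  ∑G (allG ks) (λ y → ∑G (allG ks) (λ x → δ x y · y))
    ≡⟨ G-Sum.∑-comm (allG ks) (allG ks) (λ y x → δ x y · y) ⟩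
  ∑G (allG ks) (λ x → ∑G (allG ks) (λ y → δ x y · y))
    ≡⟨ G-Sum.∑-cong (allG ks) (λ x → G-Sum.∑-allG-δ ks _ (f x) (λ y y≢fx →
         trans (cong (λ b → (if b then I x else 0) · y) (dec-false (f x ≟G y) (y≢fx ∘ sym)))
               (·-zeroˡ y))) ⟩
  ∑G (allG ks) (λ x → δ x (f x) · f x)
    ≡⟨ G-Sum.∑-cong (allG ks) (λ x →
         cong (λ b → (if b then I x else 0) · f x) (dec-true (f x ≟G f x) refl)) ⟩
  ∑G (allG ks) (λ x → I x · f x) ∎
  where
  open ≡-Reasoning
  δ : G ks → G ks → ℕ
  δ x y = if does (f x ≟G y) then I x else 0

σ-+ₘ : ∀ {ks} (I : Multiset ks) (g : G ks) → σ (I +ₘ g) ≡ σ I ⊕ ∣ I ∣ₘ · g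
σ-+ₘ {ks} I g = begin
  σ (I +ₘ g)
    ≡⟨ σ-image (_⊕ g) I ⟩
  ∑G (allG ks) (λ x → I x · (x ⊕ g))
    ≡⟨ G-Sum.∑-cong (allG ks) (λ x → ·-distribˡ-⊕ (I x) x g) ⟩
  ∑G (allG ks) (λ x → I x · x ⊕ I x · g)
    ≡⟨ G-Sum.∑-distrib (allG ks) (λ x → I x · x) (λ x → I x · g) ⟩
  σ I ⊕ ∑G (allG ks) (λ x → I x · g)
    ≡⟨ cong (σ I ⊕_) (∣∣ₘ-· I g) ⟨
  σ I ⊕ ∣ I ∣ₘ · g ∎
  where open ≡-Reasoning

σ-*ₘ : ∀ {ks} t (I : Multiset ks) → σ (t *ₘ I) ≡ t · σ I
σ-*ₘ {ks} t I = begin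
  σ (t *ₘ I)                                    ≡⟨ σ-image (t ·_) I ⟩
  ∑G (allG ks) (λ x → I x · (t · x))            ≡⟨ G-Sum.∑-cong (allG ks) commute ⟩
  ∑G (allG ks) (λ x → t · (I x · x))            ≡⟨ ·-∑G t (allG ks) (λ x → I x · x) ⟨
  t · σ I                                       ∎
  where
  open ≡-Reasoning
  commute : ∀ x → I x · (t · x) ≡ t · (I x · x)
  commute x = begin
    I x · (t · x)  ≡⟨ *-·-assoc (I x) t x ⟨
    (I x * t) · x  ≡⟨ cong (_· x) (*-comm (I x) t) ⟩
    (t * I x) · x  ≡⟨ *-·-assoc t (I x) x ⟩
    t · (I x · x)  ∎

centre : ∀ {ks} → Multiset ks → G ks
centre {ks} I = (∣ I ∣ₘ ^ (φ (exponent ks) ∸ 1)) · σ I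

multiplier-shifts-centre : ∀ {ks} (I : Multiset ks) {t g} → gcd ∣ I ∣ₘ (exponent ks) ≡ 1
  → (∀ x → (t *ₘ I) x ≡ (I +ₘ g) x) → t · centre I ≡ centre I ⊕ g
multiplier-shifts-centre {ks} I {t} {g} coprime tI≗I+g = begin
  t · (n ^ e · σ I)           ≡⟨ *-·-assoc t (n ^ e) (σ I) ⟨
  (t * n ^ e) · σ I           ≡⟨ cong (_· σ I) (*-comm t (n ^ e)) ⟩
  (n ^ e * t) · σ I           ≡⟨ *-·-assoc (n ^ e) t (σ I) ⟩
  n ^ e · (t · σ I)           ≡⟨ cong (n ^ e ·_) t·σ ⟩
  n ^ e · (σ I ⊕ n · g)       ≡⟨ ·-distribˡ-⊕ (n ^ e) (σ I) (n · g) ⟩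
  centre I ⊕ n ^ e · (n · g)  ≡⟨ cong (centre I ⊕_) (*-·-assoc (n ^ e) n g) ⟨
  centre I ⊕ (n ^ e * n) · g  ≡⟨ cong (λ m → centre I ⊕ m · g) n^e*n≡n^φ ⟩
  centre I ⊕ n ^ φ ℓ* · g     ≡⟨ cong (centre I ⊕_) (≈-exponent⇒· (Euler.euler ℓ* coprime) g) ⟩
  centre I ⊕ 1 · g            ≡⟨ cong (centre I ⊕_) (·-identityˡ g) ⟩
  centre I ⊕ g                ∎
  where
  open ≡-Reasoning
  ℓ* = exponent ks
  instance _ = exponent-nonZero ks
  n = ∣ I ∣ₘ
  e = φ ℓ* ∸ 1
  t·σ : t · σ I ≡ σ I ⊕ n · g
  t·σ = trans (sym (σ-*ₘ t I)) (trans (σ-cong tI≗I+g) (σ-+ₘ I g))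
  n^e*n≡n^φ : n ^ e * n ≡ n ^ φ ℓ*
  n^e*n≡n^φ = trans (*-comm (n ^ e) n) (cong (n ^_) (suc-pred (φ ℓ*) {{Euler.φ-nonZero ℓ*}}))

recentred-invariant : ∀ {ks} (I : Multiset ks) {t g} → gcd ∣ I ∣ₘ (exponent ks) ≡ 1
  → (∀ x y → t · x ≡ t · y → x ≡ y) → (∀ x → (t *ₘ I) x ≡ (I +ₘ g) x)
  → ∀ x → (I +ₘ (⊖ centre I)) (t · x) ≡ (I +ₘ (⊖ centre I)) x
recentred-invariant {ks} I {t} {g} coprime t·-injective tI≗I+g x = begin
  (I +ₘ (⊖ c)) (t · x)    ≡⟨ +ₘ-apply I (⊖ c) (t · x) ⟩
  I (t · x ⊕ ⊖ ⊖ c)        ≡⟨ cong (λ z → I (t · x ⊕ z)) (⁻¹-involutive c) ⟩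
  I (t · x ⊕ c)            ≡⟨ cong I shift ⟨
  I (t · (x ⊕ c) ⊕ ⊖ g)    ≡⟨ +ₘ-apply I g (t · (x ⊕ c)) ⟨
  (I +ₘ g) (t · (x ⊕ c))   ≡⟨ tI≗I+g (t · (x ⊕ c)) ⟨
  (t *ₘ I) (t · (x ⊕ c))   ≡⟨ *ₘ-apply t I t·-injective (x ⊕ c) ⟩
  I (x ⊕ c)                ≡⟨ cong (λ z → I (x ⊕ z)) (⁻¹-involutive c) ⟨
  I (x ⊕ ⊖ ⊖ c)            ≡⟨ +ₘ-apply I (⊖ c) x ⟨
  (I +ₘ (⊖ c)) x           ∎
  where
  open ≡-Reasoning
  open import Algebra.Properties.AbelianGroup (G-abelianGroup ks) using (⁻¹-involutive; //-rightDividesʳ)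
  c = centre I
  t·c≡c⊕g : t · c ≡ c ⊕ g
  t·c≡c⊕g = multiplier-shifts-centre I coprime tI≗I+g
  shift : t · (x ⊕ c) ⊕ ⊖ g ≡ t · x ⊕ c
  shift = begin
    t · (x ⊕ c) ⊕ ⊖ g        ≡⟨ cong (_⊕ ⊖ g) (·-distribˡ-⊕ t x c) ⟩
    (t · x ⊕ t · c) ⊕ ⊖ g    ≡⟨ cong (λ z → (t · x ⊕ z) ⊕ ⊖ g) t·c≡c⊕g ⟩
    (t · x ⊕ (c ⊕ g)) ⊕ ⊖ g  ≡⟨ cong (_⊕ ⊖ g) (⊕-assoc (t · x) c g) ⟨
    (t · x ⊕ c ⊕ g) ⊕ ⊖ g    ≡⟨ //-rightDividesʳ g (t · x ⊕ c) ⟩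
    t · x ⊕ c                ∎

module Orbits {ks} (K : Pred ℕ 0ℓ) (K? : Decidable K) (K-subgroup : IsUnitSubgroup ks K) where

  open IsUnitSubgroup K-subgroup

  ℓ* : ℕ
  ℓ* = exponent ks

  instance _ = exponent-nonZero ks

  infix 4 _∼_
  _∼_ : Rel (G ks) 0ℓ
  s ∼ x = T (inOrbit K K? s x)

  ∼-intro : ∀ {t s x} → K t → t · s ≡ x → s ∼ x
  ∼-intro {t} {s} {x} Kt t·s≡x =
    any⁺ _ (Any.map (λ { refl → witness }) (∈-upTo⁺ (proj₁ (⊆units t Kt))))
    where
    witness : T (does (K? t) ∧ does ((t · s) ≟G x))
    witness = Equivalence.from T-∧ (does⁺ (K? t) Kt , does⁺ ((t · s) ≟G x) t·s≡x)

  ∼-elim : ∀ {s x} → s ∼ x → ∃ λ t → K t × t · s ≡ x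
  ∼-elim {s} {x} s∼x with satisfied (any⁻ _ (upTo ℓ*) s∼x)
  ... | t , Kt∧t·s≡x with Equivalence.to T-∧ Kt∧t·s≡x
  ...   | Kt , t·s≡x = t , does⁻ (K? t) Kt , does⁻ ((t · s) ≟G x) t·s≡x

  mod*-· : ∀ t (x : G ks) → (t mod* ks) · x ≡ t · x
  mod*-· = %-· ℓ* ∣-refl

  K-inverse-action : ∀ {t} → K t → ∃ λ u → K u × ∀ x → u · (t · x) ≡ x
  K-inverse-action {t} Kt with inv t Kt
  ... | u , Ku , tu≡1 = u , Ku , λ x → begin
    u · (t · x)            ≡⟨ *-·-assoc u t x ⟨
    (u * t) · x            ≡⟨ cong (_· x) (*-comm u t) ⟩
    (t * u) · x            ≡⟨ mod*-· (t * u) x ⟨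
    ((t * u) mod* ks) · x  ≡⟨ cong (_· x) tu≡1 ⟩
    (1 mod* ks) · x        ≡⟨ mod*-· 1 x ⟩
    1 · x                  ≡⟨ ·-identityˡ x ⟩
    x                      ∎
    where open ≡-Reasoning

  K-·-injective : ∀ {t} → K t → ∀ x y → t · x ≡ t · y → x ≡ y
  K-·-injective Kt x y t·x≡t·y with K-inverse-action Kt
  ... | u , _ , u·t·≗id = trans (sym (u·t·≗id x)) (trans (cong (u ·_) t·x≡t·y) (u·t·≗id y))

  ∼-refl : ∀ {s} → s ∼ s
  ∼-refl {s} = ∼-intro one (trans (mod*-· 1 s) (·-identityˡ s))

  ∼-sym : ∀ {s x} → s ∼ x → x ∼ s
  ∼-sym s∼x with ∼-elim s∼x
  ... | t , Kt , refl with K-inverse-action Kt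
  ...   | u , Ku , u·t·≗id = ∼-intro Ku (u·t·≗id _)

  ∼-trans : ∀ {s x y} → s ∼ x → x ∼ y → s ∼ y
  ∼-trans s∼x x∼y with ∼-elim s∼x | ∼-elim x∼y
  ... | t , Kt , refl | u , Ku , refl = ∼-intro (mul u t Ku Kt) (trans (mod*-· (u * t) _) (*-·-assoc u t _))

  orbitDecSetoid : DecSetoid 0ℓ 0ℓ
  orbitDecSetoid = record
    { _≈_ = _∼_
    ; isDecEquivalence = record
      { isEquivalence = record { refl = ∼-refl ; sym = ∼-sym ; trans = ∼-trans }
      ; _≟_ = λ s x → T? (inOrbit K K? s x)
      }
    }

  open DecSetoid orbitDecSetoid using () renaming (_≟_ to _∼?_)

  ∑-orbit-representatives : ∀ (J : Multiset ks) → (∀ {s x} → s ∼ x → J s ≡ J x) → ∀ {R x}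
    → AllPairs (λ r r′ → ¬ r ∼ r′) R → Any (_∼ x) R
    → ∑ℕ R (λ r → if inOrbit K K? r x then J r else 0) ≡ J x
  ∑-orbit-representatives J J-resp {r ∷ R} {x} (r≁R ∷ R-unique) (here r∼x) = begin
    c r + ∑ℕ R c  ≡⟨ cong₂ _+_ (cong (if_then J r else 0) (Equivalence.to T-≡ r∼x)) R-zero ⟩
    J r + 0       ≡⟨ +-identityʳ (J r) ⟩
    J r           ≡⟨ J-resp r∼x ⟩
    J x           ∎
    where
    open ≡-Reasoning
    c : G ks → ℕ
    c r′ = if inOrbit K K? r′ x then J r′ else 0
    R-zero : ∑ℕ R c ≡ 0
    R-zero = ℕ-Sum.∑-ε (All.map (λ {r′} r≁r′ →
      cong (if_then J r′ else 0) (dec-false (T? _) (r≁r′ ∘ ∼-trans r∼x ∘ ∼-sym))) r≁R)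
  ∑-orbit-representatives J J-resp {r ∷ R} {x} (r≁R ∷ R-unique) (there R∼x) =
    cong₂ _+_ (cong (if_then J r else 0) (dec-false (T? _) r≁x))
              (∑-orbit-representatives J J-resp R-unique R∼x)
    where
    r≁x : ¬ r ∼ x
    r≁x r∼x = All.lookupWith (λ r≁r′ r′∼x → r≁r′ (∼-trans r∼x (∼-sym r′∼x))) r≁R R∼x

  orbit-decomposition : (J : Multiset ks) → (∀ t x → K t → J (t · x) ≡ J x)
    → ∃ λ (m : ℕ) → ∃₂ λ (s : Fin m → G ks) (α : Fin m → ℕ)
      → (∀ i j → i ≢ j → ∀ x → inOrbit K K? (s i) x ≡ true → inOrbit K K? (s j) x ≡ false)
      × (∀ x → J x ≡ unionOrbits K K? m s α x)
  orbit-decomposition J J-invariant = length R , lookup R , J ∘ lookup R , disjoint , decomposition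
    where
    R : List (G ks)
    R = deduplicate _∼?_ (allG ks)
    R-unique : AllPairs (λ r r′ → ¬ r ∼ r′) R
    R-unique = deduplicate-! orbitDecSetoid (allG ks)
    J-resp : ∀ {s x} → s ∼ x → J s ≡ J x
    J-resp s∼x with ∼-elim s∼x
    ... | t , Kt , refl = sym (J-invariant t _ Kt)
    disjoint : ∀ i j → i ≢ j → ∀ x
      → inOrbit K K? (lookup R i) x ≡ true → inOrbit K K? (lookup R j) x ≡ false
    disjoint i j i≢j x sᵢ∼x = dec-false (T? _) λ sⱼ∼x →
      AllPairs-lookup (_∘ ∼-sym) R-unique i≢j (∼-trans (Equivalence.from T-≡ sᵢ∼x) (∼-sym sⱼ∼x))
    decomposition : ∀ x → J x ≡ unionOrbits K K? (length R) (lookup R) (J ∘ lookup R) x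
    decomposition x = sym (begin
      unionOrbits K K? (length R) (lookup R) (J ∘ lookup R) x
        ≡⟨ sum-map (allFin (length R)) (c ∘ lookup R) ⟩
      ∑ℕ (allFin (length R)) (c ∘ lookup R)
        ≡⟨ ℕ-Sum.∑-map (lookup R) (allFin (length R)) c ⟨
      ∑ℕ (map (lookup R) (allFin (length R))) c
        ≡⟨ cong (λ xs → ∑ℕ xs c) (trans (map-tabulate (λ i → i) (lookup R)) (tabulate-lookup R)) ⟩
      ∑ℕ R c
        ≡⟨ ∑-orbit-representatives J J-resp R-unique
             (Anyₚ.deduplicate⁺ _∼?_ ∼-trans (Any.map (λ { refl → ∼-refl }) (∈-allG ks x))) ⟩
      J x ∎)
      where
      open ≡-Reasoning
      c : G ks → ℕ
      c r = if inOrbit K K? r x then J r else 0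

theorem8 : (ks : List ℕ) (I : Multiset ks) (K : Pred ℕ 0ℓ) (K? : Decidable K)
    → IsUnitSubgroup ks K
    → (∀ t → K t → IsMultiplier I t)
    → gcd ∣ I ∣ₘ (exponent ks) ≡ 1
    → ∃ λ (m : ℕ) → ∃₂ λ (s : Fin m → G ks) (α : Fin m → ℕ)
      → (∀ i j → i ≢ j → ∀ x → inOrbit K K? (s i) x ≡ true → inOrbit K K? (s j) x ≡ false)
      × (∀ x → (I +ₘ (⊖ ((∣ I ∣ₘ ^ (φ (exponent ks) ∸ 1)) · σ I))) x
               ≡ unionOrbits K K? m s α x)
theorem8 ks I K K? K-subgroup K-multipliers coprime =
  orbit-decomposition (I +ₘ (⊖ centre I)) invariant
  where
  open Orbits K K? K-subgroup
  invariant : ∀ t x → K t → (I +ₘ (⊖ centre I)) (t · x) ≡ (I +ₘ (⊖ centre I)) x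
  invariant t x Kt with K-multipliers t Kt
  ... | _ , g , tI≗I+g = recentred-invariant I coprime (K-·-injective Kt) tI≗I+g x
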